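{- Let $A=\{a_1<a_2<\dots\}$ and $B=\{b_1<b_2<\dots\}$ be infinite subsets of $\mathbb N=\{0,1,2,\dots\}$, enumerated in increasing order. For $k\geqslant 1$ let $A(k)=\{a_1,\dots,a_k\}$, $B(k)=\{b_1,\dots,b_k\}$, $u(k)=s(A(k))$, $v(k)=s(B(k))$, and $d(k)=\max\{|a_i-b_i| : i\leqslant k\}$. Then for every $k\geqslant 1$, $$\frac{u(k)}{4d(k)+1}\leqslant v(k)\leqslant (4d(k)+1)\,u(k).$$
   Context: For $X\subseteq \mathbb N$ and $n\in\mathbb N$, $r(X,n)$ denotes the number of ordered pairs $(x,y)\in X\times X$ with $x+y=n$, and $s(X)=\sup\{r(X,n): n\in\mathbb N\}$ (an element of $\mathbb N\cup\{\infty\}$). -}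

module Defs where

open import Data.Nat using (ℕ; suc; _+_; _*_; _∸_; _<_; _⊔_; ∣_-_∣)
open import Data.Nat.Properties using (_≟_)
open import Data.List using (List; length; filter; cartesianProduct; map; upTo; foldr)
open import Data.Product using (_,_; proj₁; proj₂)

-- A finite subset of ℕ, given as a list of its (distinct) elements.
-- r X n = number of ordered pairs (x , y) ∈ X × X with x + y = n.
r : List ℕ → ℕ → ℕ
r X n = length (filter (λ p → proj₁ p + proj₂ p ≟ n) (cartesianProduct X X))

maxList : List ℕ → ℕ
maxList = foldr _⊔_ 0

-- s X = sup over n of r X n.  For finite X, r X n = 0 whenever n > 2 * max X,
-- so the sup is the maximum over n ≤ 2 * max X.
s : List ℕ → ℕ
s X = maxList (map (r X) (upTo (suc (2 * maxList X))))

-- Strictly increasing enumeration a 0 < a 1 < ... (a i is the paper's a_{i+1}).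
StrictlyIncreasing : (ℕ → ℕ) → Set
StrictlyIncreasing a = ∀ i → a i < a (suc i)

initial : (ℕ → ℕ) → ℕ → List ℕ
initial a k = map a (upTo k)

d : (ℕ → ℕ) → (ℕ → ℕ) → ℕ → ℕ
d a b k = maxList (map (λ i → ∣ a i - b i ∣) (upTo k))

module Submission where

-- Fix any finite list L of indices and any two sequences
-- a, b with |a i - b i| ≤ D for every i in L.  Choose n with
-- s(a[L]) = r(a[L], n).  Every index pair (i , j) with a i + a j = n has
-- |(b i + b j) - n| ≤ 2D, so b i + b j lies in a window of 4D + 1 consecutive
-- integers starting at n ∸ 2D.  Counting the index pairs by the value of
-- b i + b j gives r(a[L], n) ≤ Σ_{t ≤ 4D} r(b[L], n ∸ 2D + t) ≤ (4D + 1) s(b[L]).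
-- Applied to L = [0 .. k-1] and D = d(k), in both directions, this is the
-- theorem.

open import Defs
open import Data.Nat using (ℕ; _+_; _*_; _≤_; _≥_)
open import Data.Product using (_×_)
open import Data.Nat using (_≡ᵇ_; zero; suc; _<_; _∸_; ∣_-_∣; z≤n; s≤s; s≤s⁻¹)
open import Data.Nat.Properties
open import Data.Nat.Tactic.RingSolver using (solve-∀)
open import Data.Bool using (true; false; if_then_else_)
open import Data.List using (List; []; _∷_; length; filter; cartesianProduct; map; upTo; _++_)
open import Data.List.Properties using (map-++; map-∘)
open import Data.List.Membership.Propositional using (_∈_)
open import Data.List.Membership.Propositional.Properties
  using (∈-map⁺; ∈-cartesianProduct⁻; ∈-upTo⁺)
open import Data.List.Relation.Unary.Any using (here; there)
open import Data.Product using (∃; _,_; proj₁; proj₂)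
import Data.Product as Product
open import Data.Sum using (inj₁; inj₂)
open import Relation.Nullary using (¬_; yes; no; does)
open import Relation.Nullary.Decidable using (dec-true; dec-false)
open import Relation.Binary.PropositionalEquality
open import Algebra.Properties.CommutativeSemigroup +-commutativeSemigroup using (interchange)

δ : ℕ → ℕ → ℕ
δ m n = if does (m ≟ n) then 1 else 0

δ-refl : ∀ m → δ m m ≡ 1
δ-refl m = cong (if_then 1 else 0) (dec-true (m ≟ m) refl)

δ-≢ : ∀ {m n} → ¬ m ≡ n → δ m n ≡ 0
δ-≢ {m} {n} m≢n = cong (if_then 1 else 0) (dec-false (m ≟ n) m≢n)

count : {A : Set} → (A → ℕ) → ℕ → List A → ℕ
count f n P = length (filter (λ p → f p ≟ n) P)

-- The recursion equation of count: the filter and δ both branch on the same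
-- boolean, to which does (f x ≟ n) computes, namely f x ≡ᵇ n.
count-∷ : {A : Set} (f : A → ℕ) (n : ℕ) (x : A) (P : List A) →
  count f n (x ∷ P) ≡ δ (f x) n + count f n P
count-∷ f n x P with f x ≡ᵇ n
... | true  = refl
... | false = refl

count-≡0 : {A : Set} (f : A → ℕ) (n : ℕ) (P : List A) →
  (∀ p → p ∈ P → ¬ f p ≡ n) → count f n P ≡ 0
count-≡0 f n [] _ = refl
count-≡0 f n (x ∷ P) none = begin
  count f n (x ∷ P)        ≡⟨ count-∷ f n x P ⟩
  δ (f x) n + count f n P  ≡⟨ cong₂ _+_ (δ-≢ (none x (here refl)))
                                        (count-≡0 f n P (λ p p∈P → none p (there p∈P))) ⟩
  0                        ∎
  where open ≡-Reasoning

count-map : {A B : Set} (f : B → ℕ) (h : A → B) (n : ℕ) (P : List A) →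
  count f n (map h P) ≡ count (λ p → f (h p)) n P
count-map f h n [] = refl
count-map f h n (x ∷ P) = begin
  count f n (map h (x ∷ P))                  ≡⟨ count-∷ f n (h x) (map h P) ⟩
  δ (f (h x)) n + count f n (map h P)        ≡⟨ cong (δ (f (h x)) n +_) (count-map f h n P) ⟩
  δ (f (h x)) n + count (λ p → f (h p)) n P  ≡⟨ count-∷ (λ p → f (h p)) n x P ⟨
  count (λ p → f (h p)) n (x ∷ P)            ∎
  where open ≡-Reasoning

∑ : ℕ → (ℕ → ℕ) → ℕ
∑ zero    f = 0
∑ (suc W) f = f W + ∑ W f

∑-cong : ∀ W {f g : ℕ → ℕ} → (∀ t → f t ≡ g t) → ∑ W f ≡ ∑ W g
∑-cong zero    f≗g = refl
∑-cong (suc W) f≗g = cong₂ _+_ (f≗g W) (∑-cong W f≗g)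

∑-distrib-+ : ∀ W (f g : ℕ → ℕ) → ∑ W (λ t → f t + g t) ≡ ∑ W f + ∑ W g
∑-distrib-+ zero    f g = refl
∑-distrib-+ (suc W) f g =
  trans (cong (f W + g W +_) (∑-distrib-+ W f g)) (interchange (f W) (g W) (∑ W f) (∑ W g))

term≤∑ : ∀ {W t} (f : ℕ → ℕ) → t < W → f t ≤ ∑ W f
term≤∑ {suc W} f t<1+W with m≤n⇒m<n∨m≡n (s≤s⁻¹ t<1+W)
... | inj₁ t<W  = ≤-trans (term≤∑ f t<W) (m≤n+m (∑ W f) (f W))
... | inj₂ refl = m≤m+n (f W) (∑ W f)

∑-bound : ∀ W {f : ℕ → ℕ} {c} → (∀ t → f t ≤ c) → ∑ W f ≤ W * c
∑-bound zero    f≤c = z≤n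
∑-bound (suc W) f≤c = +-mono-≤ (f≤c W) (∑-bound W f≤c)

δ-window : ∀ {lo w m} → lo ≤ m → m ≤ lo + w → 1 ≤ ∑ (suc w) (λ t → δ m (lo + t))
δ-window {lo} {w} {m} lo≤m m≤lo+w = begin
  1                     ≡⟨ δ-refl m ⟨
  δ m m                 ≡⟨ cong (δ m) (m+[n∸m]≡n lo≤m) ⟨
  δ m (lo + (m ∸ lo))   ≤⟨ term≤∑ (λ t → δ m (lo + t)) (s≤s (m≤n+o⇒m∸n≤o m lo m≤lo+w)) ⟩
  ∑ (suc w) (λ t → δ m (lo + t)) ∎
  where open ≤-Reasoning

count-window : {A : Set} (f g : A → ℕ) (n lo w : ℕ) (P : List A) →
  (∀ p → p ∈ P → f p ≡ n → lo ≤ g p × g p ≤ lo + w) →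
  count f n P ≤ ∑ (suc w) (λ t → count g (lo + t) P)
count-window f g n lo w []      _     = z≤n
count-window f g n lo w (x ∷ P) inWin = begin
  count f n (x ∷ P)
    ≡⟨ count-∷ f n x P ⟩
  δ (f x) n + count f n P
    ≤⟨ +-mono-≤ head (count-window f g n lo w P (λ p p∈P → inWin p (there p∈P))) ⟩
  ∑ (suc w) (λ t → δ (g x) (lo + t)) + ∑ (suc w) (λ t → count g (lo + t) P)
    ≡⟨ ∑-distrib-+ (suc w) (λ t → δ (g x) (lo + t)) (λ t → count g (lo + t) P) ⟨
  ∑ (suc w) (λ t → δ (g x) (lo + t) + count g (lo + t) P)
    ≡⟨ ∑-cong (suc w) (λ t → count-∷ g (lo + t) x P) ⟨
  ∑ (suc w) (λ t → count g (lo + t) (x ∷ P)) ∎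
  where
  open ≤-Reasoning
  head : δ (f x) n ≤ ∑ (suc w) (λ t → δ (g x) (lo + t))
  head with f x ≟ n
  ... | no  fx≢n = ≤-trans (≤-reflexive (δ-≢ fx≢n)) z≤n
  ... | yes fx≡n = ≤-trans (≤-reflexive (trans (cong (λ m → δ m n) fx≡n) (δ-refl n)))
                           (Product.uncurry δ-window (inWin x (here refl) fx≡n))

≤-maxList : ∀ {x xs} → x ∈ xs → x ≤ maxList xs
≤-maxList {xs = y ∷ ys} (here refl) = m≤m⊔n y (maxList ys)
≤-maxList {xs = y ∷ ys} (there x∈ys) = ≤-trans (≤-maxList x∈ys) (m≤n⊔m y (maxList ys))

maxList-attained : (f : ℕ → ℕ) (xs : List ℕ) → ∃ λ n → maxList (map f xs) ≤ f n
maxList-attained f [] = 0 , z≤n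
maxList-attained f (x ∷ xs) with maxList-attained f xs
... | n , max≤fn with ≤-total (f x) (f n)
...   | inj₁ fx≤fn = n , ⊔-lub fx≤fn max≤fn
...   | inj₂ fn≤fx = x , ⊔-lub ≤-refl (≤-trans max≤fn fn≤fx)

r-vanishes : ∀ X n → 2 * maxList X < n → r X n ≡ 0
r-vanishes X n 2max<n = count-≡0 (λ p → proj₁ p + proj₂ p) n (cartesianProduct X X) tooSmall
  where
  tooSmall : ∀ p → p ∈ cartesianProduct X X → ¬ proj₁ p + proj₂ p ≡ n
  tooSmall (x , y) xy∈ x+y≡n with ∈-cartesianProduct⁻ X X xy∈
  ... | x∈X , y∈X = <⇒≢ (≤-<-trans sum≤2max 2max<n) x+y≡n
    where
    sum≤2max : x + y ≤ 2 * maxList X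
    sum≤2max = ≤-trans (+-mono-≤ (≤-maxList x∈X) (≤-maxList y∈X))
                       (≤-reflexive (cong (maxList X +_) (sym (+-identityʳ (maxList X)))))

r≤s : ∀ X n → r X n ≤ s X
r≤s X n with n ≤? 2 * maxList X
... | yes n≤2max = ≤-maxList (∈-map⁺ (r X) (∈-upTo⁺ (s≤s n≤2max)))
... | no  n≰2max = ≤-trans (≤-reflexive (r-vanishes X n (≰⇒> n≰2max))) z≤n

s-attained : ∀ X → ∃ λ n → s X ≤ r X n
s-attained X = maxList-attained (r X) (upTo (suc (2 * maxList X)))

cartesianProduct-map : {A B C D : Set} (f : A → C) (g : B → D) (xs : List A) (ys : List B) →
  cartesianProduct (map f xs) (map g ys) ≡ map (Product.map f g) (cartesianProduct xs ys)
cartesianProduct-map f g [] ys = refl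
cartesianProduct-map f g (x ∷ xs) ys = begin
  map (f x ,_) (map g ys) ++ cartesianProduct (map f xs) (map g ys)
    ≡⟨ cong₂ _++_ (sym (map-∘ ys)) (cartesianProduct-map f g xs ys) ⟩
  map (λ y → f x , g y) ys ++ map (Product.map f g) (cartesianProduct xs ys)
    ≡⟨ cong (_++ _) (map-∘ ys) ⟩
  map (Product.map f g) (map (x ,_) ys) ++ map (Product.map f g) (cartesianProduct xs ys)
    ≡⟨ map-++ (Product.map f g) (map (x ,_) ys) _ ⟨
  map (Product.map f g) (map (x ,_) ys ++ cartesianProduct xs ys) ∎
  where open ≡-Reasoning

pairSum : (ℕ → ℕ) → ℕ × ℕ → ℕ
pairSum a (i , j) = a i + a j

r-map : ∀ (a : ℕ → ℕ) L n → r (map a L) n ≡ count (pairSum a) n (cartesianProduct L L)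
r-map a L n = trans (cong (count (λ p → proj₁ p + proj₂ p) n) (cartesianProduct-map a a L L))
                    (count-map (λ p → proj₁ p + proj₂ p) (Product.map a a) n (cartesianProduct L L))

sum-close : ∀ x₁ x₂ y₁ y₂ {D} → ∣ x₁ - y₁ ∣ ≤ D → ∣ x₂ - y₂ ∣ ≤ D →
  x₁ + x₂ ≤ (y₁ + y₂) + (D + D)
sum-close x₁ x₂ y₁ y₂ {D} gap₁ gap₂ = begin
  x₁ + x₂                            ≤⟨ +-mono-≤ (m≤∣m-n∣+n x₁ y₁) (m≤∣m-n∣+n x₂ y₂) ⟩
  (∣ x₁ - y₁ ∣ + y₁) + (∣ x₂ - y₂ ∣ + y₂) ≤⟨ +-mono-≤ (+-monoˡ-≤ y₁ gap₁) (+-monoˡ-≤ y₂ gap₂) ⟩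
  (D + y₁) + (D + y₂)                ≡⟨ rearrange D y₁ y₂ ⟩
  (y₁ + y₂) + (D + D)                ∎
  where
  open ≤-Reasoning
  rearrange : ∀ D y₁ y₂ → (D + y₁) + (D + y₂) ≡ (y₁ + y₂) + (D + D)
  rearrange = solve-∀

window : ∀ {x y e} → x ≤ y + e → y ≤ x + e → y ∸ e ≤ x × x ≤ (y ∸ e) + (e + e)
window {x} {y} {e} x≤y+e y≤x+e = m≤n+o⇒m∸n≤o y e (≤-trans y≤x+e (≤-reflexive (+-comm x e))) , (begin
  x                   ≤⟨ x≤y+e ⟩
  y + e               ≤⟨ +-monoˡ-≤ e (m≤m∸n+n y e) ⟩
  ((y ∸ e) + e) + e   ≡⟨ +-assoc (y ∸ e) e e ⟩
  (y ∸ e) + (e + e)   ∎)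
  where
  open ≤-Reasoning
  m≤m∸n+n : ∀ m n → m ≤ (m ∸ n) + n
  m≤m∸n+n m n = ≤-trans (m≤n+m∸n m n) (≤-reflexive (+-comm n (m ∸ n)))

comparison : ∀ (a b : ℕ → ℕ) (L : List ℕ) D → (∀ i → i ∈ L → ∣ a i - b i ∣ ≤ D) →
  s (map a L) ≤ (4 * D + 1) * s (map b L)
comparison a b L D close with s-attained (map a L)
... | n , s≤r = begin
  s (map a L)                                       ≤⟨ s≤r ⟩
  r (map a L) n                                     ≡⟨ r-map a L n ⟩
  count (pairSum a) n IJ                            ≤⟨ count-window (pairSum a) (pairSum b) n lo (e + e) IJ inWindow ⟩
  ∑ (suc (e + e)) (λ t → count (pairSum b) (lo + t) IJ) ≡⟨ ∑-cong (suc (e + e)) (λ t → r-map b L (lo + t)) ⟨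
  ∑ (suc (e + e)) (λ t → r (map b L) (lo + t))      ≤⟨ ∑-bound (suc (e + e)) (λ t → r≤s (map b L) (lo + t)) ⟩
  suc (e + e) * s (map b L)                         ≡⟨ cong (_* s (map b L)) (width D) ⟩
  (4 * D + 1) * s (map b L)                         ∎
  where
  open ≤-Reasoning
  e  = D + D
  lo = n ∸ e
  IJ = cartesianProduct L L
  width : ∀ D → suc ((D + D) + (D + D)) ≡ 4 * D + 1
  width = solve-∀
  inWindow : ∀ p → p ∈ IJ → pairSum a p ≡ n → lo ≤ pairSum b p × pairSum b p ≤ lo + (e + e)
  inWindow (i , j) ij∈ refl with ∈-cartesianProduct⁻ L L ij∈
  ... | i∈L , j∈L = window {e = e} (sum-close (b i) (b j) (a i) (a j) (close′ i∈L) (close′ j∈L))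
                               (sum-close (a i) (a j) (b i) (b j) (close i i∈L) (close j j∈L))
    where
    close′ : ∀ {i} → i ∈ L → ∣ b i - a i ∣ ≤ D
    close′ {i} i∈L = ≤-trans (≤-reflexive (∣-∣-comm (b i) (a i))) (close i i∈L)

mainTheorem1 : (a b : ℕ → ℕ) → StrictlyIncreasing a → StrictlyIncreasing b →
    ∀ k → k ≥ 1 →
    (s (initial a k) ≤ (4 * d a b k + 1) * s (initial b k))
    × (s (initial b k) ≤ (4 * d a b k + 1) * s (initial a k))
mainTheorem1 a b _ _ k _ =
  comparison a b (upTo k) (d a b k) gap≤d ,
  comparison b a (upTo k) (d a b k) (λ i i∈ → ≤-trans (≤-reflexive (∣-∣-comm (b i) (a i))) (gap≤d i i∈))
  where
  gap≤d : ∀ i → i ∈ upTo k → ∣ a i - b i ∣ ≤ d a b k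
  gap≤d i i∈ = ≤-maxList (∈-map⁺ (λ i → ∣ a i - b i ∣) i∈)
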